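{- Let $m,n$ be even positive integers and let $M$ be an $m\times n$ matrix with integer entries and of rank $r\geq1$, which contains no constant $m/2\times n/2$ submatrix. Then $q(M)\geq\frac{1}{128r}$.
   Context: For a real $m\times n$ matrix $M$, $p(M)=\frac1{mn}\sum_{i,j}M(i,j)$ and $q(M)=\frac1{mn}\sum_{i,j}(M(i,j)-p(M))^2$. A constant submatrix is one all of whose entries are equal; submatrices are obtained by selecting arbitrary sets of rows and columns. -}

module Defs where

open import Data.Nat as ℕ using (ℕ; zero; suc; NonZero; _≤_)
open import Data.Nat.Properties using (m*n≢0)
open import Data.Integer as ℤ using (ℤ; +_)
open import Data.Rational as ℚ using (ℚ; 0ℚ; _+_; _*_; _-_; _/_)
open import Data.Fin using (Fin) renaming (zero to fzero; suc to fsuc)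
open import Data.Fin.Subset using (Subset; _∈_; ∣_∣)
open import Data.Product using (Σ; ∃; _×_)
open import Relation.Binary.PropositionalEquality using (_≡_)

-- Real m×n matrices are represented by rational ones (all quantities below
-- are rational for an integer matrix); integer matrices are Fin m → Fin n → ℤ.
Mat : Set → ℕ → ℕ → Set
Mat A m n = Fin m → Fin n → A

∑ : ∀ {k} → (Fin k → ℚ) → ℚ
∑ {zero}  f = 0ℚ
∑ {suc k} f = f fzero + ∑ (λ i → f (fsuc i))

toℚ : ∀ {m n} → Mat ℤ m n → Mat ℚ m n
toℚ M i j = M i j / 1

p : ∀ {m n} .{{_ : NonZero m}} .{{_ : NonZero n}} → Mat ℤ m n → ℚ
p {m} {n} M = (+ 1 / (m ℕ.* n)) {{m*n≢0 m n}} * ∑ (λ i → ∑ (λ j → toℚ M i j))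

q : ∀ {m n} .{{_ : NonZero m}} .{{_ : NonZero n}} → Mat ℤ m n → ℚ
q {m} {n} M = (+ 1 / (m ℕ.* n)) {{m*n≢0 m n}}
  * ∑ (λ i → ∑ (λ j → (toℚ M i j - p M) * (toℚ M i j - p M)))

RankAtMost : ∀ {m n} → Mat ℤ m n → ℕ → Set
RankAtMost {m} {n} M k =
  Σ (Mat ℚ m k) λ A → Σ (Mat ℚ k n) λ B →
    ∀ i j → toℚ M i j ≡ ∑ (λ l → A i l * B l j)

HasRank : ∀ {m n} → Mat ℤ m n → ℕ → Set
HasRank M r = RankAtMost M r × (∀ k → RankAtMost M k → r ≤ k)

HasConstSubmatrix : ∀ {m n} → Mat ℤ m n → ℕ → ℕ → Set
HasConstSubmatrix {m} {n} M a b =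
  Σ (Subset m) λ R → Σ (Subset n) λ C → ∣ R ∣ ≡ a × ∣ C ∣ ≡ b ×
    ∃ λ c → ∀ i j → i ∈ R → j ∈ C → M i j ≡ c

{-# OPTIONS --safe #-}
-- Write d = mn and S = Σ M(i,j). The scaled deviations d·M(i,j) − S are integers and
-- q(M) = Σ (d·M(i,j) − S)² / d³. Let c be the integer nearest to the mean S/d: an entry
-- different from c is at distance at least 1/2 from the mean, so if q(M) < 1/(128r) then
-- fewer than mn/(32r) ≤ mn/(4(r+1)) entries differ from c. The rows of M − c lie in the
-- span of r + 1 vectors (the rows of B in M = AB, and the all-ones row). Call a row sparse
-- if it has at most w = ⌊n/(2(r+1))⌋ nonzero entries; by Markov's inequality at least half
-- of the rows are sparse. Greedily picking sparse rows that have a pivot outside the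
-- supports picked so far yields an echelon family, hence at most r + 1 rows, whose supports
-- cover those of all sparse rows; they meet at most (r+1)w ≤ n/2 columns. Half of the
-- sparse rows and half of the remaining columns form a constant block of value c.
module Submission where

open import Defs

module LowRankVariance where

  open import Algebra.Bundles using (CommutativeRing)
  import Algebra.Properties.Semiring.Sum as SemiringSum
  open import Data.Empty using (⊥-elim)
  open import Data.Fin.Base using (Fin; punchIn) renaming (zero to fzero; suc to fsuc)
  open import Data.Fin.Properties using (any?)
  open import Data.Fin.Subset using (Subset; _∈_; ∣_∣; ⊥; inside; outside)
  open import Data.Fin.Subset.Properties using (∣⊥∣≡0; ∉⊥)
  open import Data.Integer.Base as ℤ using (ℤ; +_; _⊖_)
  open import Data.Integer.DivMod using (_%ℕ_; _/ℕ_; a≡a%ℕn+[a/ℕn]*n; n%ℕd<d)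
  import Data.Integer.Properties as ℤP
  import Data.Integer.Tactic.RingSolver as ℤSolver
  open import Data.List.Base using (List; []; _∷_; length; tabulate)
  open import Data.List.Relation.Unary.All as All using (All; []; _∷_)
  open import Data.List.Relation.Unary.All.Properties using (¬Any⇒All¬; tabulate⁺; tabulate⁻)
  open import Data.List.Relation.Unary.Any as Any using (Any; here; there)
  open import Data.Nat.Base as ℕ using (ℕ; zero; suc; NonZero; _≤_; _<_; z≤n; s≤s; _/_)
  open import Data.Nat.DivMod using (m*n/n≡m; m/n*n≤m; /-monoˡ-≤)
  import Data.Nat.Properties as ℕP
  open import Data.Nat.Properties using (m*n≢0)
  import Data.Nat.Tactic.RingSolver as ℕSolver
  open import Data.Product.Base using (Σ; ∃; _×_; _,_; proj₁; proj₂)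
  open import Data.Rational.Base as ℚ using (ℚ; toℚᵘ; 0ℚ; 1ℚ; _+_; _*_; _-_; -_; 1/_)
  import Data.Rational.Properties as ℚP
  open import Data.Rational.Solver using (module +-*-Solver)
  open import Data.Rational.Unnormalised.Base as ℚᵘ using (mkℚᵘ; *≡*; *≤*)
  import Data.Rational.Unnormalised.Properties as ℚᵘP
  open import Data.Sum.Base as Sum using (_⊎_; inj₁; inj₂)
  import Data.Vec.Base as Vec
  open import Function.Base using (_∘_)
  open import Relation.Binary.PropositionalEquality
  open import Relation.Nullary using (¬_; Dec; yes; no; ¬?; _×-dec_)
  open import Relation.Nullary.Decidable using (decidable-stable; toSum)
  open import Relation.Unary using (Decidable)
  open import Relation.Unary.Properties using (∁?)

  open import Algebra.Properties.Group ℚP.+-0-group using (inverseʳ-unique; x∙y⁻¹≈ε⇒x≈y)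
  open SemiringSum (CommutativeRing.semiring ℚP.+-*-commutativeRing)
    using (sum; sum-cong-≗; sum-remove; ∑-distrib-+; *-distribˡ-sum)
  module ℕΣ = SemiringSum ℕP.+-*-semiring
  module ℤΣ = SemiringSum ℤP.+-*-semiring

  fromℤ : ℤ → ℚ
  fromℤ z = z ℚ./ 1

  toℚᵘ-/ : ∀ z k → toℚᵘ (z ℚ./ suc k) ℚᵘ.≃ mkℚᵘ z k
  toℚᵘ-/ z k = ℚP.toℚᵘ-fromℚᵘ (mkℚᵘ z k)

  fromℤ-by-toℚᵘ : ∀ z {p} → toℚᵘ p ℚᵘ.≃ mkℚᵘ z 0 → fromℤ z ≡ p
  fromℤ-by-toℚᵘ z p≃z = ℚP.toℚᵘ-injective (ℚᵘP.≃-trans (toℚᵘ-/ z 0) (ℚᵘP.≃-sym p≃z))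

  fromℤ-homo-+ : ∀ a b → fromℤ (a ℤ.+ b) ≡ fromℤ a + fromℤ b
  fromℤ-homo-+ a b = fromℤ-by-toℚᵘ (a ℤ.+ b) (ℚᵘP.≃-trans (ℚP.toℚᵘ-homo-+ (fromℤ a) (fromℤ b))
    (ℚᵘP.≃-trans (ℚᵘP.+-cong (toℚᵘ-/ a 0) (toℚᵘ-/ b 0))
      (*≡* (cong (ℤ._* + 1) (cong₂ ℤ._+_ (ℤP.*-identityʳ a) (ℤP.*-identityʳ b))))))

  fromℤ-homo-* : ∀ a b → fromℤ (a ℤ.* b) ≡ fromℤ a * fromℤ b
  fromℤ-homo-* a b = fromℤ-by-toℚᵘ (a ℤ.* b) (ℚᵘP.≃-trans (ℚP.toℚᵘ-homo-* (fromℤ a) (fromℤ b))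
    (ℚᵘP.≃-trans (ℚᵘP.*-cong (toℚᵘ-/ a 0) (toℚᵘ-/ b 0)) (*≡* refl)))

  fromℤ-homo‿- : ∀ a → fromℤ (ℤ.- a) ≡ - fromℤ a
  fromℤ-homo‿- a = fromℤ-by-toℚᵘ (ℤ.- a) (ℚᵘP.≃-trans (ℚP.toℚᵘ-homo‿- (fromℤ a))
    (ℚᵘP.≃-trans (ℚᵘP.-‿cong (toℚᵘ-/ a 0)) (*≡* refl)))

  fromℤ-homo-sub : ∀ a b → fromℤ (a ℤ.- b) ≡ fromℤ a - fromℤ b
  fromℤ-homo-sub a b = trans (fromℤ-homo-+ a (ℤ.- b)) (cong (_+_ (fromℤ a)) (fromℤ-homo‿- b))

  fromℤ-injective : ∀ {a b} → fromℤ a ≡ fromℤ b → a ≡ b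
  fromℤ-injective {a} {b} eq
    with *≡* a*1≡b*1 ← ℚᵘP.≃-trans (ℚᵘP.≃-sym (toℚᵘ-/ a 0))
                         (ℚᵘP.≃-trans (ℚP.toℚᵘ-cong eq) (toℚᵘ-/ b 0))
    = trans (sym (ℤP.*-identityʳ a)) (trans a*1≡b*1 (ℤP.*-identityʳ b))

  1/n*n≡1 : ∀ n .{{_ : NonZero n}} → (+ 1 ℚ./ n) * fromℤ (+ n) ≡ 1ℚ
  1/n*n≡1 (suc k) = ℚP.toℚᵘ-injective (ℚᵘP.≃-trans (ℚP.toℚᵘ-homo-* (+ 1 ℚ./ suc k) (fromℤ (+ suc k)))
    (ℚᵘP.≃-trans (ℚᵘP.*-cong (toℚᵘ-/ (+ 1) k) (toℚᵘ-/ (+ suc k) 0)) (*≡* (cong (λ x → + suc x) (identity k)))))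
    where
    identity : ∀ k → (k ℕ.+ 0 ℕ.* suc k) ℕ.* 1 ≡ k ℕ.* 1 ℕ.+ 0 ℕ.* suc (k ℕ.* 1)
    identity = ℕSolver.solve-∀

  1/R≤T/d³ : ∀ {d R T} .{{_ : NonZero d}} .{{_ : NonZero R}} → d ℕ.* d ℕ.* d ≤ R ℕ.* T →
             + 1 ℚ./ R ℚ.≤ (+ 1 ℚ./ d) * ((+ 1 ℚ./ d) * (+ 1 ℚ./ d) * fromℤ (+ T))
  1/R≤T/d³ {suc k} {suc R-1} {T} d³≤RT = ℚP.toℚᵘ-cancel-≤
    (ℚᵘP.≤-respʳ-≃ (ℚᵘP.≃-sym rhs≃)
      (ℚᵘP.≤-respˡ-≃ (ℚᵘP.≃-sym (toℚᵘ-/ (+ 1) R-1)) (*≤* cross-multiplied)))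
    where
    u : ℚ
    u = + 1 ℚ./ suc k
    rhs≃ : toℚᵘ (u * (u * u * fromℤ (+ T))) ℚᵘ.≃
           mkℚᵘ (+ 1) k ℚᵘ.* (mkℚᵘ (+ 1) k ℚᵘ.* mkℚᵘ (+ 1) k ℚᵘ.* mkℚᵘ (+ T) 0)
    rhs≃ = ℚᵘP.≃-trans (ℚP.toℚᵘ-homo-* u _) (ℚᵘP.*-cong (toℚᵘ-/ (+ 1) k)
      (ℚᵘP.≃-trans (ℚP.toℚᵘ-homo-* (u * u) _) (ℚᵘP.*-cong
        (ℚᵘP.≃-trans (ℚP.toℚᵘ-homo-* u u) (ℚᵘP.*-cong (toℚᵘ-/ (+ 1) k) (toℚᵘ-/ (+ 1) k))) (toℚᵘ-/ (+ T) 0))))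
    cube : ∀ x → x ℕ.* (x ℕ.* x ℕ.* 1) ≡ x ℕ.* x ℕ.* x
    cube = ℕSolver.solve-∀
    rearrange : ∀ R T → R ℤ.* T ≡ + 1 ℤ.* (+ 1 ℤ.* + 1 ℤ.* T) ℤ.* R
    rearrange = ℤSolver.solve-∀
    cross-multiplied : + 1 ℤ.* + (suc k ℕ.* (suc k ℕ.* suc k ℕ.* 1)) ℤ.≤ + 1 ℤ.* (+ 1 ℤ.* + 1 ℤ.* + T) ℤ.* + suc R-1
    cross-multiplied = begin
      + 1 ℤ.* + (suc k ℕ.* (suc k ℕ.* suc k ℕ.* 1))  ≡⟨ ℤP.*-identityˡ _ ⟩
      + (suc k ℕ.* (suc k ℕ.* suc k ℕ.* 1))          ≡⟨ cong +_ (cube (suc k)) ⟩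
      + (suc k ℕ.* suc k ℕ.* suc k)                  ≤⟨ ℤ.+≤+ d³≤RT ⟩
      + (suc R-1 ℕ.* T)                              ≡⟨ ℤP.pos-* (suc R-1) T ⟩
      + suc R-1 ℤ.* + T                              ≡⟨ rearrange (+ suc R-1) (+ T) ⟩
      + 1 ℤ.* (+ 1 ℤ.* + 1 ℤ.* + T) ℤ.* + suc R-1    ∎
      where open ℤP.≤-Reasoning

  ∑≡sum : ∀ {k} (f : Fin k → ℚ) → ∑ f ≡ sum f
  ∑≡sum {zero}  f = refl
  ∑≡sum {suc k} f = cong (_+_ (f fzero)) (∑≡sum (λ i → f (fsuc i)))

  ∑∑≡sumsum : ∀ {k l} (f : Fin k → Fin l → ℚ) → ∑ (λ i → ∑ (f i)) ≡ sum (λ i → sum (f i))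
  ∑∑≡sumsum f = trans (∑≡sum (λ i → ∑ (f i))) (sum-cong-≗ (λ i → ∑≡sum (f i)))

  fromℤ-sum : ∀ {k} (f : Fin k → ℤ) → sum (λ i → fromℤ (f i)) ≡ fromℤ (ℤΣ.sum f)
  fromℤ-sum {zero}  f = refl
  fromℤ-sum {suc k} f = trans (cong (_+_ (fromℤ (f fzero))) (fromℤ-sum (λ i → f (fsuc i))))
    (sym (fromℤ-homo-+ (f fzero) _))

  fromℕ-sum : ∀ {k} (f : Fin k → ℕ) → sum (λ i → fromℤ (+ f i)) ≡ fromℤ (+ ℕΣ.sum f)
  fromℕ-sum {zero}  f = refl
  fromℕ-sum {suc k} f = trans (cong (_+_ (fromℤ (+ f fzero))) (fromℕ-sum (λ i → f (fsuc i))))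
    (sym (fromℤ-homo-+ (+ f fzero) (+ ℕΣ.sum (λ i → f (fsuc i)))))

  sum≢0⇒∃≢0 : ∀ {k} (f : Fin k → ℚ) → sum f ≢ 0ℚ → ∃ λ i → f i ≢ 0ℚ
  sum≢0⇒∃≢0 {zero}  f sum≢0 = ⊥-elim (sum≢0 refl)
  sum≢0⇒∃≢0 {suc k} f sum≢0 with f fzero ℚP.≟ 0ℚ
  ... | no f₀≢0 = fzero , f₀≢0
  ... | yes f₀≡0 =
    let i , fᵢ≢0 = sum≢0⇒∃≢0 (λ i → f (fsuc i)) (λ rest≡0 → sum≢0 (cong₂ _+_ f₀≡0 rest≡0))
    in fsuc i , fᵢ≢0

  sum-mono-≤ : ∀ {k} {f g : Fin k → ℕ} → (∀ i → f i ≤ g i) → ℕΣ.sum f ≤ ℕΣ.sum g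
  sum-mono-≤ {zero}  f≤g = z≤n
  sum-mono-≤ {suc k} f≤g = ℕP.+-mono-≤ (f≤g fzero) (sum-mono-≤ (λ i → f≤g (fsuc i)))

  indicator : ∀ {A : Set} → Dec A → ℕ
  indicator (yes _) = 1
  indicator (no _)  = 0

  count : ∀ {k} {P : Fin k → Set} → Decidable P → ℕ
  count P? = ℕΣ.sum (λ i → indicator (P? i))

  count-mono : ∀ {k} {P Q : Fin k → Set} (P? : Decidable P) (Q? : Decidable Q) →
               (∀ i → P i → Q i) → count P? ≤ count Q?
  count-mono P? Q? P⇒Q = sum-mono-≤ (λ i → pointwise (P? i) (Q? i) (P⇒Q i))
    where
    pointwise : ∀ {A B : Set} (a : Dec A) (b : Dec B) → (A → B) → indicator a ≤ indicator b
    pointwise (yes a) (yes _) _   = ℕP.≤-refl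
    pointwise (yes a) (no ¬b) a⇒b = ⊥-elim (¬b (a⇒b a))
    pointwise (no _)  _       _   = z≤n

  count-∪ : ∀ {k} {P Q R : Fin k → Set} (P? : Decidable P) (Q? : Decidable Q) (R? : Decidable R) →
            (∀ i → R i → P i ⊎ Q i) → count R? ≤ count P? ℕ.+ count Q?
  count-∪ P? Q? R? R⇒P∪Q = ℕP.≤-trans (sum-mono-≤ (λ i → pointwise (P? i) (Q? i) (R? i) (R⇒P∪Q i)))
    (ℕP.≤-reflexive (ℕΣ.∑-distrib-+ (λ i → indicator (P? i)) (λ i → indicator (Q? i))))
    where
    pointwise : ∀ {A B C : Set} (a : Dec A) (b : Dec B) (c : Dec C) → (C → A ⊎ B) →
                indicator c ≤ indicator a ℕ.+ indicator b
    pointwise _       _       (no _)  _ = z≤n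
    pointwise (yes _) _       (yes _) _ = s≤s z≤n
    pointwise (no _)  (yes _) (yes _) _ = s≤s z≤n
    pointwise (no ¬a) (no ¬b) (yes c) c⇒a⊎b with c⇒a⊎b c
    ... | inj₁ a = ⊥-elim (¬a a)
    ... | inj₂ b = ⊥-elim (¬b b)

  count+count-∁ : ∀ {k} {P : Fin k → Set} (P? : Decidable P) → count P? ℕ.+ count (∁? P?) ≡ k
  count+count-∁ {zero}  P? = refl
  count+count-∁ {suc k} P? = trans (interchange (P? fzero) _ _)
    (cong suc (count+count-∁ (λ i → P? (fsuc i))))
    where
    interchange : ∀ {A : Set} (a : Dec A) x y →
                  (indicator a ℕ.+ x) ℕ.+ (indicator (¬? a) ℕ.+ y) ≡ suc (x ℕ.+ y)
    interchange (yes _) x y = refl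
    interchange (no _)  x y = ℕP.+-suc x y

  markov-count : ∀ {k} (f : Fin k → ℕ) w {D : Fin k → Set} (D? : Decidable D) →
                 (∀ i → D i → w < f i) → count D? ℕ.* suc w ≤ ℕΣ.sum f
  markov-count f w D? D⇒w<f = ℕP.≤-trans (ℕP.≤-reflexive (ℕΣ.*-distribʳ-sum (suc w) (λ i → indicator (D? i))))
    (sum-mono-≤ (λ i → pointwise (D? i) (D⇒w<f i)))
    where
    pointwise : ∀ {A : Set} {x} (a : Dec A) → (A → w < x) → indicator a ℕ.* suc w ≤ x
    pointwise (yes a) a⇒w<x = ℕP.≤-trans (ℕP.≤-reflexive (ℕP.*-identityˡ (suc w))) (a⇒w<x a)
    pointwise (no _)  _     = z≤n

  subset-of-size : ∀ {k} {P : Fin k → Set} (P? : Decidable P) t → t ≤ count P? →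
                   Σ (Subset k) λ R → ∣ R ∣ ≡ t × (∀ i → i ∈ R → P i)
  subset-of-size {k} P? zero _ = ⊥ , ∣⊥∣≡0 k , λ i i∈⊥ → ⊥-elim (∉⊥ i∈⊥)
  subset-of-size {suc k} P? (suc t) t<count with P? fzero
  ... | yes P₀ =
    let R , ∣R∣≡t , R⊆P = subset-of-size (λ i → P? (fsuc i)) t (ℕP.≤-pred t<count)
    in inside Vec.∷ R , cong suc ∣R∣≡t , λ { fzero _ → P₀ ; (fsuc i) (Vec.there i∈R) → R⊆P i i∈R }
  ... | no _ =
    let R , ∣R∣≡t , R⊆P = subset-of-size (λ i → P? (fsuc i)) (suc t) t<count
    in outside Vec.∷ R , ∣R∣≡t , λ { (fsuc i) (Vec.there i∈R) → R⊆P i i∈R }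

  half-≤ : ∀ {k x y} → x ℕ.+ y ≡ k → 2 ℕ.* y ≤ k → k / 2 ≤ x
  half-≤ {x = x} {y} refl 2y≤x+y = begin
    (x ℕ.+ y) / 2  ≤⟨ /-monoˡ-≤ 2 (ℕP.+-monoʳ-≤ x y≤x) ⟩
    (x ℕ.+ x) / 2  ≡⟨ cong (_/ 2) (x+x≡x*2 x) ⟩
    x ℕ.* 2 / 2    ≡⟨ m*n/n≡m x 2 ⟩
    x              ∎
    where
    open ℕP.≤-Reasoning
    x+x≡x*2 : ∀ x → x ℕ.+ x ≡ x ℕ.* 2
    x+x≡x*2 = ℕSolver.solve-∀
    y≤x : y ≤ x
    y≤x = ℕP.+-cancelʳ-≤ y y x (ℕP.≤-trans (ℕP.≤-reflexive (cong (y ℕ.+_) (sym (ℕP.+-identityʳ y)))) 2y≤x+y)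

  majority-subset : ∀ {k} {P Q : Fin k → Set} (P? : Decidable P) (Q? : Decidable Q) →
                    (∀ i → ¬ P i → Q i) → 2 ℕ.* count Q? ≤ k →
                    Σ (Subset k) λ R → ∣ R ∣ ≡ k / 2 × (∀ i → i ∈ R → P i)
  majority-subset P? Q? ¬P⇒Q 2Q≤k = subset-of-size P? _ (half-≤ (count+count-∁ P?)
    (ℕP.≤-trans (ℕP.*-monoʳ-≤ 2 (count-mono (∁? P?) Q? ¬P⇒Q)) 2Q≤k))

  nonzero? : ∀ {n} (u : Fin n → ℚ) → Decidable (λ j → u j ≢ 0ℚ)
  nonzero? u j = ¬? (u j ℚP.≟ 0ℚ)

  nnz : ∀ {n} → (Fin n → ℚ) → ℕ
  nnz u = count (nonzero? u)

  nnzᴹ : ∀ {m n} → (Fin m → Fin n → ℚ) → ℕ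
  nnzᴹ V = ℕΣ.sum (λ i → nnz (V i))

  InSpan : ∀ {s n} → (Fin s → Fin n → ℚ) → (Fin n → ℚ) → Set
  InSpan {s} b v = Σ (Fin s → ℚ) λ a → ∀ j → v j ≡ sum (λ l → a l * b l j)

  module Elimination {s n} (b : Fin (suc s) → Fin n → ℚ) (l₀ : Fin (suc s)) (j : Fin n)
                     (b≢0 : b l₀ j ≢ 0ℚ) where
    open +-*-Solver

    ι : ℚ
    ι = (1/ b l₀ j) {{ℚ.≢-nonZero b≢0}}

    b′ : Fin s → Fin n → ℚ
    b′ k col = b (punchIn l₀ k) col - (b (punchIn l₀ k) j * ι) * b l₀ col

    InSpan-eliminate : ∀ {v} → InSpan b v → v j ≡ 0ℚ → InSpan b′ v
    InSpan-eliminate {v} (a , v≡) vⱼ≡0 = a′ , λ col → sym (begin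
      sum (λ k → a′ k * b′ k col)
        ≡⟨ sum-cong-≗ (λ k → expand (a′ k) (b (punchIn l₀ k) col) (b (punchIn l₀ k) j) ι (b l₀ col)) ⟩
      sum (λ k → a′ k * b (punchIn l₀ k) col + μ col * (a′ k * b (punchIn l₀ k) j))
        ≡⟨ ∑-distrib-+ (λ k → a′ k * b (punchIn l₀ k) col) (λ k → μ col * (a′ k * b (punchIn l₀ k) j)) ⟩
      rest col + sum (λ k → μ col * (a′ k * b (punchIn l₀ k) j))
        ≡⟨ cong (_+_ (rest col)) (sym (*-distribˡ-sum (μ col) (λ k → a′ k * b (punchIn l₀ k) j))) ⟩
      rest col + μ col * rest j
        ≡⟨ cong (λ x → rest col + μ col * x) restⱼ≡ ⟩
      rest col + μ col * - (a l₀ * b l₀ j)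
        ≡⟨ regroup (rest col) ι (b l₀ col) (a l₀) (b l₀ j) ⟩
      a l₀ * b l₀ col * (b l₀ j * ι) + rest col
        ≡⟨ cong (λ x → a l₀ * b l₀ col * x + rest col) (ℚP.*-inverseʳ (b l₀ j) {{ℚ.≢-nonZero b≢0}}) ⟩
      a l₀ * b l₀ col * 1ℚ + rest col
        ≡⟨ cong (_+ rest col) (ℚP.*-identityʳ (a l₀ * b l₀ col)) ⟩
      a l₀ * b l₀ col + rest col
        ≡⟨ sym (v-split col) ⟩
      v col ∎)
      where
      open ≡-Reasoning
      a′ : Fin s → ℚ
      a′ k = a (punchIn l₀ k)
      μ : Fin n → ℚ
      μ col = - (ι * b l₀ col)
      rest : Fin n → ℚ
      rest col = sum (λ k → a′ k * b (punchIn l₀ k) col)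
      v-split : ∀ col → v col ≡ a l₀ * b l₀ col + rest col
      v-split col = trans (v≡ col) (sum-remove {i = l₀} (λ l → a l * b l col))
      restⱼ≡ : rest j ≡ - (a l₀ * b l₀ j)
      restⱼ≡ = inverseʳ-unique (a l₀ * b l₀ j) (rest j) (trans (sym (v-split j)) vⱼ≡0)
      expand : ∀ x y z i w → x * (y - (z * i) * w) ≡ x * y + (- (i * w)) * (x * z)
      expand = solve 5 (λ x y z i w → x :* (y :- (z :* i) :* w) := x :* y :+ (:- (i :* w)) :* (x :* z)) refl
      regroup : ∀ r i w x z → r + (- (i * w)) * (- (x * z)) ≡ x * w * (z * i) + r
      regroup = solve 5 (λ r i w x z → r :+ (:- (i :* w)) :* (:- (x :* z)) := x :* w :* (z :* i) :+ r) refl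

  Pivot : ∀ {n} → (Fin n → ℚ) → List (Fin n → ℚ) → Set
  Pivot u us = ∃ λ j → u j ≢ 0ℚ × All (λ v → v j ≡ 0ℚ) us

  data Echelon {n} : List (Fin n → ℚ) → Set where
    []  : Echelon []
    _∷_ : ∀ {u us} → Pivot u us → Echelon us → Echelon (u ∷ us)

  nonzero-generator : ∀ {s n} {b : Fin s → Fin n → ℚ} {u} j → InSpan b u → u j ≢ 0ℚ → ∃ λ l → b l j ≢ 0ℚ
  nonzero-generator {b = b} j (a , u≡) uⱼ≢0
    with l , abₗ≢0 ← sum≢0⇒∃≢0 (λ l → a l * b l j) (λ sum≡0 → uⱼ≢0 (trans (u≡ j) sum≡0))
    = l , λ bₗ≡0 → abₗ≢0 (trans (cong (λ x → a l * x) bₗ≡0) (ℚP.*-zeroʳ (a l)))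

  echelon-length : ∀ {s n} (b : Fin s → Fin n → ℚ) {us} → Echelon us → All (InSpan b) us → length us ≤ s
  echelon-length b [] [] = z≤n
  echelon-length {zero} b ((j , uⱼ≢0 , _) ∷ _) ((a , u≡) ∷ _) = ⊥-elim (uⱼ≢0 (u≡ j))
  echelon-length {suc s} b ((j , uⱼ≢0 , usⱼ≡0) ∷ ech) (u∈ ∷ us∈) =
    let l₀ , bⱼ≢0 = nonzero-generator {b = b} j u∈ uⱼ≢0
        open Elimination b l₀ j bⱼ≢0
    in s≤s (echelon-length b′ ech (All.zipWith (λ (v∈ , vⱼ≡0) → InSpan-eliminate v∈ vⱼ≡0) (us∈ , usⱼ≡0)))

  InSupport : ∀ {n} → List (Fin n → ℚ) → Fin n → Set
  InSupport us j = Any (λ u → u j ≢ 0ℚ) us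

  InSupport? : ∀ {n} (us : List (Fin n → ℚ)) → Decidable (InSupport us)
  InSupport? us j = Any.any? (λ u → nonzero? u j) us

  count-InSupport : ∀ {n w} (us : List (Fin n → ℚ)) → All (λ u → nnz u ≤ w) us →
                    count (InSupport? us) ≤ length us ℕ.* w
  count-InSupport {n} [] [] = ℕP.≤-reflexive (ℕΣ.sum-replicate-zero n)
  count-InSupport (u ∷ us) (u≤w ∷ us≤w) = ℕP.≤-trans
    (count-∪ (nonzero? u) (InSupport? us) (InSupport? (u ∷ us))
      (λ { j (here uⱼ≢0) → inj₁ uⱼ≢0 ; j (there j∈) → inj₂ j∈ }))
    (ℕP.+-mono-≤ u≤w (count-InSupport us us≤w))

  module _ {s n} (b : Fin s → Fin n → ℚ) {P : (Fin n → ℚ) → Set} (P? : Decidable P) where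

    record SupportCover (vs : List (Fin n → ℚ)) : Set where
      field
        basis   : List (Fin n → ℚ)
        echelon : Echelon basis
        chosen  : All (λ u → P u × InSpan b u) basis
        covers  : All (λ v → P v → ∀ j → v j ≢ 0ℚ → InSupport basis j) vs

    -- A vector in P whose support is not yet covered has a pivot outside the supports of
    -- the basis, so adding it keeps the basis in echelon form.
    greedy-cover : ∀ vs → All (InSpan b) vs → SupportCover vs
    greedy-cover []       []         = record { basis = [] ; echelon = [] ; chosen = [] ; covers = [] }
    greedy-cover (v ∷ vs) (v∈ ∷ vs∈) = extend v∈ (P? v) (greedy-cover vs vs∈)
      where
      extend : ∀ {v vs} → InSpan b v → Dec (P v) → SupportCover vs → SupportCover (v ∷ vs)
      extend {v} v∈ (no ¬Pv) cov = record
        { basis = basis ; echelon = echelon ; chosen = chosen ; covers = (λ Pv → ⊥-elim (¬Pv Pv)) ∷ covers }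
        where open SupportCover cov
      extend {v} v∈ (yes Pv) cov with any? (λ j → nonzero? v j ×-dec ∁? (InSupport? (SupportCover.basis cov)) j)
      ... | yes (j , vⱼ≢0 , j∉) = record
        { basis   = v ∷ basis
        ; echelon = (j , vⱼ≢0 , basisⱼ≡0) ∷ echelon
        ; chosen  = (Pv , v∈) ∷ chosen
        ; covers  = (λ _ j′ vⱼ′≢0 → here vⱼ′≢0) ∷ All.map (λ c Pw j′ wⱼ′≢0 → there (c Pw j′ wⱼ′≢0)) covers
        }
        where
        open SupportCover cov
        basisⱼ≡0 : All (λ u → u j ≡ 0ℚ) basis
        basisⱼ≡0 = All.map (λ {u} uⱼ≢0 → decidable-stable (u j ℚP.≟ 0ℚ) uⱼ≢0) (¬Any⇒All¬ basis j∉)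
      ... | no ¬new = record
        { basis = basis ; echelon = echelon ; chosen = chosen
        ; covers = (λ _ j′ vⱼ′≢0 → covered j′ vⱼ′≢0) ∷ covers }
        where
        open SupportCover cov
        covered : ∀ j → v j ≢ 0ℚ → InSupport basis j
        covered j vⱼ≢0 = decidable-stable (InSupport? basis j) (λ j∉ → ¬new (j , vⱼ≢0 , j∉))

  n<[1+n/k]*k : ∀ n k .{{_ : NonZero k}} → n < suc (n / k) ℕ.* k
  n<[1+n/k]*k n k = ℕP.≰⇒> λ [1+n/k]*k≤n →
    ℕP.1+n≰n (subst (_≤ n / k) (m*n/n≡m (suc (n / k)) k) (/-monoˡ-≤ k [1+n/k]*k≤n))

  few-dense-rows : ∀ {m n s D N w} → D ℕ.* suc w ≤ N → 4 ℕ.* s ℕ.* N < m ℕ.* n →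
                   n < suc w ℕ.* (2 ℕ.* s) → 2 ℕ.* D ≤ m
  few-dense-rows {m} {n} {s} {D} {N} {w} D[1+w]≤N 4sN<mn n<[1+w]2s =
    ℕP.<⇒≤ (ℕP.*-cancelʳ-< (suc w ℕ.* (2 ℕ.* s)) (2 ℕ.* D) m (begin-strict
      2 ℕ.* D ℕ.* (suc w ℕ.* (2 ℕ.* s))  ≡⟨ rearrange D (suc w) s ⟩
      4 ℕ.* s ℕ.* (D ℕ.* suc w)          ≤⟨ ℕP.*-monoʳ-≤ (4 ℕ.* s) D[1+w]≤N ⟩
      4 ℕ.* s ℕ.* N                      <⟨ 4sN<mn ⟩
      m ℕ.* n                            ≤⟨ ℕP.*-monoʳ-≤ m (ℕP.<⇒≤ n<[1+w]2s) ⟩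
      m ℕ.* (suc w ℕ.* (2 ℕ.* s))        ∎))
    where
    open ℕP.≤-Reasoning
    rearrange : ∀ D x s → 2 ℕ.* D ℕ.* (x ℕ.* (2 ℕ.* s)) ≡ 4 ℕ.* s ℕ.* (D ℕ.* x)
    rearrange = ℕSolver.solve-∀

  2s[n/2s]≤n : ∀ n s .{{_ : NonZero s}} → 2 ℕ.* (s ℕ.* (n / (2 ℕ.* s)) {{m*n≢0 2 s}}) ≤ n
  2s[n/2s]≤n n s = ℕP.≤-trans (ℕP.≤-reflexive (rearrange s ((n / (2 ℕ.* s)) {{m*n≢0 2 s}})))
    (m/n*n≤m n (2 ℕ.* s) {{m*n≢0 2 s}})
    where
    rearrange : ∀ s x → 2 ℕ.* (s ℕ.* x) ≡ x ℕ.* (2 ℕ.* s)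
    rearrange = ℕSolver.solve-∀

  sparse-low-rank⇒zero-block : ∀ {m n s} .{{_ : NonZero s}} (V : Fin m → Fin n → ℚ) (b : Fin s → Fin n → ℚ) →
    (∀ i → InSpan b (V i)) → 4 ℕ.* s ℕ.* nnzᴹ V < m ℕ.* n →
    Σ (Subset m) λ R → Σ (Subset n) λ C → ∣ R ∣ ≡ m / 2 × ∣ C ∣ ≡ n / 2 ×
      (∀ i j → i ∈ R → j ∈ C → V i j ≡ 0ℚ)
  sparse-low-rank⇒zero-block {m} {n} {s} V b rows∈span 4sN<mn =
    let R , ∣R∣ , R-sparse = majority-subset (Sparse? ∘ V) (∁? (Sparse? ∘ V)) (λ _ dense → dense) few-dense
        C , ∣C∣ , C-uncovered = majority-subset (∁? (InSupport? basis)) (InSupport? basis)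
                                  (λ j ¬uncovered → decidable-stable (InSupport? basis j) ¬uncovered) few-covered
    in R , C , ∣R∣ , ∣C∣ , λ i j i∈R j∈C → decidable-stable (V i j ℚP.≟ 0ℚ)
         (λ Vᵢⱼ≢0 → C-uncovered j j∈C (tabulate⁻ covers i (R-sparse i i∈R) j Vᵢⱼ≢0))
    where
    instance
      2s≢0 : NonZero (2 ℕ.* s)
      2s≢0 = m*n≢0 2 s
    w : ℕ
    w = n / (2 ℕ.* s)
    Sparse? : Decidable (λ u → nnz u ≤ w)
    Sparse? u = nnz u ℕP.≤? w
    few-dense : 2 ℕ.* count (∁? (Sparse? ∘ V)) ≤ m
    few-dense = few-dense-rows {s = s} {D = count (∁? (Sparse? ∘ V))} {w = w}
      (markov-count (nnz ∘ V) w (∁? (Sparse? ∘ V)) (λ _ → ℕP.≰⇒>)) 4sN<mn (n<[1+n/k]*k n (2 ℕ.* s))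
    open SupportCover (greedy-cover b Sparse? (tabulate V) (tabulate⁺ rows∈span))
    few-covered : 2 ℕ.* count (InSupport? basis) ≤ n
    few-covered = ℕP.≤-trans (ℕP.*-monoʳ-≤ 2 (ℕP.≤-trans (count-InSupport basis (All.map proj₁ chosen))
      (ℕP.*-monoˡ-≤ w (echelon-length b echelon (All.map proj₂ chosen))))) (2s[n/2s]≤n n s)

  almost-constant⇒const-block : ∀ {m n} (M : Mat ℤ m n) r → RankAtMost M r → (c : ℤ) →
    4 ℕ.* suc r ℕ.* nnzᴹ (λ i j → toℚ M i j - fromℤ c) < m ℕ.* n → HasConstSubmatrix M (m / 2) (n / 2)
  almost-constant⇒const-block {m} {n} M r (A , B , M≡AB) c few-off =
    let R , C , ∣R∣ , ∣C∣ , V≡0 = sparse-low-rank⇒zero-block V b rows∈span few-off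
    in R , C , ∣R∣ , ∣C∣ , c , λ i j i∈R j∈C → fromℤ-injective (x∙y⁻¹≈ε⇒x≈y _ _ (V≡0 i j i∈R j∈C))
    where
    V : Fin m → Fin n → ℚ
    V i j = toℚ M i j - fromℤ c
    b : Fin (suc r) → Fin n → ℚ
    b fzero    _ = 1ℚ
    b (fsuc l)   = B l
    rows∈span : ∀ i → InSpan b (V i)
    rows∈span i = a , λ j → trans (cong (_- fromℤ c) (trans (M≡AB i j) (∑≡sum (λ l → A i l * B l j))))
      (shift (sum (λ l → A i l * B l j)) (fromℤ c))
      where
      a : Fin (suc r) → ℚ
      a fzero    = - fromℤ c
      a (fsuc l) = A i l
      open +-*-Solver
      shift : ∀ x y → x - y ≡ - y * 1ℚ + x
      shift = solve 2 (λ x y → x :- y := :- y :* con 1ℚ :+ x) refl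

  roundDiv : ℤ → (d : ℕ) .{{_ : NonZero d}} → ℤ
  roundDiv S d = ((+ 2 ℤ.* S ℤ.+ + d) /ℕ (2 ℕ.* d)) {{m*n≢0 2 d}}

  ∣m⊖n∣≤m : ∀ m n → n < m ℕ.+ m → ℤ.∣ m ⊖ n ∣ ≤ m
  ∣m⊖n∣≤m m n n<2m with ℕP.≤-total n m
  ... | inj₁ n≤m = ℕP.≤-trans (ℕP.≤-reflexive (cong ℤ.∣_∣ (ℤP.⊖-≥ n≤m))) (ℕP.m∸n≤m m n)
  ... | inj₂ m≤n = ℕP.≤-trans (ℕP.≤-reflexive (ℤP.∣⊖∣-≤ m≤n)) (ℕP.m≤n+o⇒m∸n≤o n m (ℕP.<⇒≤ n<2m))

  -- Writing 2S + d = ρ + c·2d with 0 ≤ ρ < 2d, the doubled error 2(dc − S) is d − ρ.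
  roundDiv-doubled-error : ∀ S d .{{_ : NonZero d}} →
    + 2 ℤ.* (+ d ℤ.* roundDiv S d ℤ.- S) ≡ + d ℤ.- + _%ℕ_ (+ 2 ℤ.* S ℤ.+ + d) (2 ℕ.* d) {{m*n≢0 2 d}}
  roundDiv-doubled-error S d = begin
    + 2 ℤ.* (+ d ℤ.* c ℤ.- S)                            ≡⟨ identity (+ d) c S (+ ρ) ⟩
    + ρ ℤ.+ c ℤ.* (+ 2 ℤ.* + d) ℤ.- a ℤ.+ (+ d ℤ.- + ρ)  ≡⟨ cong (λ x → x ℤ.- a ℤ.+ (+ d ℤ.- + ρ)) a≡ ⟩
    a ℤ.- a ℤ.+ (+ d ℤ.- + ρ)                            ≡⟨ cong (ℤ._+ (+ d ℤ.- + ρ)) (ℤP.+-inverseʳ a) ⟩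
    + 0 ℤ.+ (+ d ℤ.- + ρ)                                ≡⟨ ℤP.+-identityˡ (+ d ℤ.- + ρ) ⟩
    + d ℤ.- + ρ                                          ∎
    where
    open ≡-Reasoning
    instance
      2d≢0 : NonZero (2 ℕ.* d)
      2d≢0 = m*n≢0 2 d
    a : ℤ
    a = + 2 ℤ.* S ℤ.+ + d
    ρ : ℕ
    ρ = a %ℕ (2 ℕ.* d)
    c : ℤ
    c = roundDiv S d
    identity : ∀ d c S ρ →
               + 2 ℤ.* (d ℤ.* c ℤ.- S) ≡ ρ ℤ.+ c ℤ.* (+ 2 ℤ.* d) ℤ.- (+ 2 ℤ.* S ℤ.+ d) ℤ.+ (d ℤ.- ρ)
    identity = ℤSolver.solve-∀
    a≡ : + ρ ℤ.+ c ℤ.* (+ 2 ℤ.* + d) ≡ a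
    a≡ = sym (trans (a≡a%ℕn+[a/ℕn]*n a (2 ℕ.* d)) (cong (λ x → + ρ ℤ.+ c ℤ.* x) (ℤP.pos-* 2 d)))

  roundDiv-error : ∀ S d .{{_ : NonZero d}} → ℤ.∣ + 2 ℤ.* (+ d ℤ.* roundDiv S d ℤ.- S) ∣ ≤ d
  roundDiv-error S d = begin
    ℤ.∣ + 2 ℤ.* (+ d ℤ.* roundDiv S d ℤ.- S) ∣  ≡⟨ cong ℤ.∣_∣ (roundDiv-doubled-error S d) ⟩
    ℤ.∣ + d ℤ.- + ρ ∣                           ≡⟨ cong ℤ.∣_∣ (ℤP.m-n≡m⊖n d ρ) ⟩
    ℤ.∣ d ⊖ ρ ∣                                 ≤⟨ ∣m⊖n∣≤m d ρ ρ<d+d ⟩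
    d                                           ∎
    where
    open ℕP.≤-Reasoning
    instance
      2d≢0 : NonZero (2 ℕ.* d)
      2d≢0 = m*n≢0 2 d
    ρ : ℕ
    ρ = (+ 2 ℤ.* S ℤ.+ + d) %ℕ (2 ℕ.* d)
    ρ<d+d : ρ < d ℕ.+ d
    ρ<d+d = subst (ρ <_) (cong (d ℕ.+_) (ℕP.+-identityʳ d)) (n%ℕd<d (+ 2 ℤ.* S ℤ.+ + d) (2 ℕ.* d))

  far-from-roundDiv : ∀ {S : ℤ} {d c x} → ℤ.∣ + 2 ℤ.* (+ d ℤ.* c ℤ.- S) ∣ ≤ d → x ≢ c →
                      d ≤ 2 ℕ.* ℤ.∣ + d ℤ.* x ℤ.- S ∣
  far-from-roundDiv {S} {d} {c} {x} c-near x≢c = ℕP.+-cancelʳ-≤ d d (2 ℕ.* ℤ.∣ y ∣) (begin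
    d ℕ.+ d                                  ≤⟨ ℕP.m≤m*n (d ℕ.+ d) ℤ.∣ x ℤ.- c ∣ {{∣x-c∣≢0}} ⟩
    (d ℕ.+ d) ℕ.* ℤ.∣ x ℤ.- c ∣              ≡⟨ sym (ℤP.abs-* (+ (d ℕ.+ d)) (x ℤ.- c)) ⟩
    ℤ.∣ + (d ℕ.+ d) ℤ.* (x ℤ.- c) ∣          ≡⟨ cong ℤ.∣_∣ 2d[x-c]≡2y-2t ⟩
    ℤ.∣ + 2 ℤ.* y ℤ.- + 2 ℤ.* t ∣            ≤⟨ ℤP.∣i-j∣≤∣i∣+∣j∣ (+ 2 ℤ.* y) (+ 2 ℤ.* t) ⟩
    ℤ.∣ + 2 ℤ.* y ∣ ℕ.+ ℤ.∣ + 2 ℤ.* t ∣      ≤⟨ ℕP.+-monoʳ-≤ ℤ.∣ + 2 ℤ.* y ∣ c-near ⟩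
    ℤ.∣ + 2 ℤ.* y ∣ ℕ.+ d                    ≡⟨ cong (ℕ._+ d) (ℤP.abs-* (+ 2) y) ⟩
    2 ℕ.* ℤ.∣ y ∣ ℕ.+ d                      ∎)
    where
    open ℕP.≤-Reasoning
    y t : ℤ
    y = + d ℤ.* x ℤ.- S
    t = + d ℤ.* c ℤ.- S
    ∣x-c∣≢0 : NonZero ℤ.∣ x ℤ.- c ∣
    ∣x-c∣≢0 = ℕ.≢-nonZero (λ ∣x-c∣≡0 → x≢c (ℤP.i-j≡0⇒i≡j x c (ℤP.∣i∣≡0⇒i≡0 ∣x-c∣≡0)))
    identity : ∀ d x c S → (d ℤ.+ d) ℤ.* (x ℤ.- c) ≡ + 2 ℤ.* (d ℤ.* x ℤ.- S) ℤ.- + 2 ℤ.* (d ℤ.* c ℤ.- S)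
    identity = ℤSolver.solve-∀
    2d[x-c]≡2y-2t : + (d ℕ.+ d) ℤ.* (x ℤ.- c) ≡ + 2 ℤ.* y ℤ.- + 2 ℤ.* t
    2d[x-c]≡2y-2t = trans (cong (ℤ._* (x ℤ.- c)) (ℤP.pos-+ d d)) (identity (+ d) x c S)

  4[1+r]≤32r : ∀ r .{{_ : NonZero r}} → 4 ℕ.* suc r ≤ 32 ℕ.* r
  4[1+r]≤32r (suc k) = ℕP.≤-trans (ℕP.≤-reflexive (lhs k))
    (ℕP.≤-trans (ℕP.+-mono-≤ (ℕP.m≤m+n 8 24) (ℕP.*-monoˡ-≤ k (ℕP.m≤m+n 4 28))) (ℕP.≤-reflexive (sym (rhs k))))
    where
    lhs : ∀ k → 4 ℕ.* suc (suc k) ≡ 8 ℕ.+ 4 ℕ.* k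
    lhs = ℕSolver.solve-∀
    rhs : ∀ k → 32 ℕ.* suc k ≡ 32 ℕ.+ 32 ℕ.* k
    rhs = ℕSolver.solve-∀

  few-off-entries : ∀ {r d N T} .{{_ : NonZero r}} → N ℕ.* (d ℕ.* d) ≤ 4 ℕ.* T →
                    ¬ (d ℕ.* d ℕ.* d ≤ 128 ℕ.* r ℕ.* T) → 4 ℕ.* suc r ℕ.* N < d
  few-off-entries {r} {d} {N} {T} Nd²≤4T d³≰128rT = ℕP.*-cancelʳ-< (d ℕ.* d) (4 ℕ.* suc r ℕ.* N) d (begin-strict
    4 ℕ.* suc r ℕ.* N ℕ.* (d ℕ.* d)    ≡⟨ ℕP.*-assoc (4 ℕ.* suc r) N (d ℕ.* d) ⟩
    4 ℕ.* suc r ℕ.* (N ℕ.* (d ℕ.* d))  ≤⟨ ℕP.*-mono-≤ (4[1+r]≤32r r) Nd²≤4T ⟩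
    32 ℕ.* r ℕ.* (4 ℕ.* T)             ≡⟨ rearrange r T ⟩
    128 ℕ.* r ℕ.* T                    <⟨ ℕP.≰⇒> d³≰128rT ⟩
    d ℕ.* d ℕ.* d                      ≡⟨ ℕP.*-assoc d d d ⟩
    d ℕ.* (d ℕ.* d)                    ∎)
    where
    open ℕP.≤-Reasoning
    rearrange : ∀ r T → 32 ℕ.* r ℕ.* (4 ℕ.* T) ≡ 128 ℕ.* r ℕ.* T
    rearrange = ℕSolver.solve-∀

  module Deviation {m n : ℕ} .{{_ : NonZero m}} .{{_ : NonZero n}} (M : Mat ℤ m n) where

    d : ℕ
    d = m ℕ.* n

    instance
      d≢0 : NonZero d
      d≢0 = m*n≢0 m n

    S : ℤ
    S = ℤΣ.sum (λ i → ℤΣ.sum (M i))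

    dev : Fin m → Fin n → ℤ
    dev i j = + d ℤ.* M i j ℤ.- S

    dev² : Fin m → Fin n → ℕ
    dev² i j = ℤ.∣ dev i j ∣ ℕ.* ℤ.∣ dev i j ∣

    sumSq : ℕ
    sumSq = ℕΣ.sum (λ i → ℕΣ.sum (dev² i))

    private
      d⁻¹ : ℚ
      d⁻¹ = + 1 ℚ./ d

    p≡S/d : p M ≡ d⁻¹ * fromℤ S
    p≡S/d = cong (_*_ d⁻¹) (begin
      ∑ (λ i → ∑ (toℚ M i))                  ≡⟨ ∑∑≡sumsum (toℚ M) ⟩
      sum (λ i → sum (λ j → fromℤ (M i j)))  ≡⟨ sum-cong-≗ (λ i → fromℤ-sum (M i)) ⟩
      sum (λ i → fromℤ (ℤΣ.sum (M i)))       ≡⟨ fromℤ-sum (λ i → ℤΣ.sum (M i)) ⟩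
      fromℤ S                                ∎)
      where open ≡-Reasoning

    centred≡dev/d : ∀ i j → toℚ M i j - p M ≡ d⁻¹ * fromℤ (dev i j)
    centred≡dev/d i j = begin
      fromℤ (M i j) - p M
        ≡⟨ cong (λ x → fromℤ (M i j) - x) p≡S/d ⟩
      fromℤ (M i j) - d⁻¹ * fromℤ S
        ≡⟨ cong (λ x → x - d⁻¹ * fromℤ S) (sym (ℚP.*-identityˡ (fromℤ (M i j)))) ⟩
      1ℚ * fromℤ (M i j) - d⁻¹ * fromℤ S
        ≡⟨ cong (λ x → x * fromℤ (M i j) - d⁻¹ * fromℤ S) (sym (1/n*n≡1 d)) ⟩
      d⁻¹ * fromℤ (+ d) * fromℤ (M i j) - d⁻¹ * fromℤ S
        ≡⟨ factor d⁻¹ (fromℤ (+ d)) (fromℤ (M i j)) (fromℤ S) ⟩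
      d⁻¹ * (fromℤ (+ d) * fromℤ (M i j) - fromℤ S)
        ≡⟨ cong (λ x → d⁻¹ * (x - fromℤ S)) (sym (fromℤ-homo-* (+ d) (M i j))) ⟩
      d⁻¹ * (fromℤ (+ d ℤ.* M i j) - fromℤ S)
        ≡⟨ cong (_*_ d⁻¹) (sym (fromℤ-homo-sub (+ d ℤ.* M i j) S)) ⟩
      d⁻¹ * fromℤ (dev i j) ∎
      where
      open ≡-Reasoning
      open +-*-Solver
      factor : ∀ k D x S → k * D * x - k * S ≡ k * (D * x - S)
      factor = solve 4 (λ k D x S → k :* D :* x :- k :* S := k :* (D :* x :- S)) refl

    q≡sumSq/d³ : q M ≡ d⁻¹ * (d⁻¹ * d⁻¹ * fromℤ (+ sumSq))
    q≡sumSq/d³ = cong (_*_ d⁻¹) (begin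
      ∑ (λ i → ∑ (λ j → (toℚ M i j - p M) * (toℚ M i j - p M)))
        ≡⟨ ∑∑≡sumsum (λ i j → (toℚ M i j - p M) * (toℚ M i j - p M)) ⟩
      sum (λ i → sum (λ j → (toℚ M i j - p M) * (toℚ M i j - p M)))
        ≡⟨ sum-cong-≗ (λ i → sum-cong-≗ (square i)) ⟩
      sum (λ i → sum (λ j → d⁻¹ * d⁻¹ * fromℤ (+ dev² i j)))
        ≡⟨ sum-cong-≗ (λ i → sym (*-distribˡ-sum (d⁻¹ * d⁻¹) (λ j → fromℤ (+ dev² i j)))) ⟩
      sum (λ i → d⁻¹ * d⁻¹ * sum (λ j → fromℤ (+ dev² i j)))
        ≡⟨ sym (*-distribˡ-sum (d⁻¹ * d⁻¹) (λ i → sum (λ j → fromℤ (+ dev² i j)))) ⟩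
      d⁻¹ * d⁻¹ * sum (λ i → sum (λ j → fromℤ (+ dev² i j)))
        ≡⟨ cong (_*_ (d⁻¹ * d⁻¹)) (sum-cong-≗ (λ i → fromℕ-sum (dev² i))) ⟩
      d⁻¹ * d⁻¹ * sum (λ i → fromℤ (+ ℕΣ.sum (dev² i)))
        ≡⟨ cong (_*_ (d⁻¹ * d⁻¹)) (fromℕ-sum (λ i → ℕΣ.sum (dev² i))) ⟩
      d⁻¹ * d⁻¹ * fromℤ (+ sumSq) ∎)
      where
      open ≡-Reasoning
      open +-*-Solver
      i*i≡+∣i∣*∣i∣ : ∀ i → i ℤ.* i ≡ + (ℤ.∣ i ∣ ℕ.* ℤ.∣ i ∣)
      i*i≡+∣i∣*∣i∣ (+ k)      = sym (ℤP.pos-* k k)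
      i*i≡+∣i∣*∣i∣ ℤ.-[1+ k ] = refl
      square : ∀ i j → (toℚ M i j - p M) * (toℚ M i j - p M) ≡ d⁻¹ * d⁻¹ * fromℤ (+ dev² i j)
      square i j = begin
        (toℚ M i j - p M) * (toℚ M i j - p M)
          ≡⟨ cong₂ _*_ (centred≡dev/d i j) (centred≡dev/d i j) ⟩
        d⁻¹ * fromℤ (dev i j) * (d⁻¹ * fromℤ (dev i j))
          ≡⟨ solve 2 (λ k y → k :* y :* (k :* y) := k :* k :* (y :* y)) refl d⁻¹ (fromℤ (dev i j)) ⟩
        d⁻¹ * d⁻¹ * (fromℤ (dev i j) * fromℤ (dev i j))
          ≡⟨ cong (_*_ (d⁻¹ * d⁻¹)) (sym (fromℤ-homo-* (dev i j) (dev i j))) ⟩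
        d⁻¹ * d⁻¹ * fromℤ (dev i j ℤ.* dev i j)
          ≡⟨ cong (λ x → d⁻¹ * d⁻¹ * fromℤ x) (i*i≡+∣i∣*∣i∣ (dev i j)) ⟩
        d⁻¹ * d⁻¹ * fromℤ (+ dev² i j) ∎

    off-entries-bound : ∀ c → ℤ.∣ + 2 ℤ.* (+ d ℤ.* c ℤ.- S) ∣ ≤ d →
                        nnzᴹ (λ i j → toℚ M i j - fromℤ c) ℕ.* (d ℕ.* d) ≤ 4 ℕ.* sumSq
    off-entries-bound c c-near = begin
      ℕΣ.sum (λ i → nnz (V i)) ℕ.* (d ℕ.* d)
        ≡⟨ ℕΣ.*-distribʳ-sum (d ℕ.* d) (nnz ∘ V) ⟩
      ℕΣ.sum (λ i → nnz (V i) ℕ.* (d ℕ.* d))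
        ≡⟨ ℕΣ.sum-cong-≗ (λ i → ℕΣ.*-distribʳ-sum (d ℕ.* d) (off i)) ⟩
      ℕΣ.sum (λ i → ℕΣ.sum (λ j → off i j ℕ.* (d ℕ.* d)))
        ≤⟨ sum-mono-≤ (λ i → sum-mono-≤ (entry-bound i)) ⟩
      ℕΣ.sum (λ i → ℕΣ.sum (λ j → 4 ℕ.* dev² i j))
        ≡⟨ ℕΣ.sum-cong-≗ (λ i → sym (ℕΣ.*-distribˡ-sum 4 (dev² i))) ⟩
      ℕΣ.sum (λ i → 4 ℕ.* ℕΣ.sum (dev² i))
        ≡⟨ sym (ℕΣ.*-distribˡ-sum 4 (λ i → ℕΣ.sum (dev² i))) ⟩
      4 ℕ.* sumSq ∎
      where
      open ℕP.≤-Reasoning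
      V : Fin m → Fin n → ℚ
      V i j = toℚ M i j - fromℤ c
      off : Fin m → Fin n → ℕ
      off i j = indicator (nonzero? (V i) j)
      square : ∀ x → 2 ℕ.* x ℕ.* (2 ℕ.* x) ≡ 4 ℕ.* (x ℕ.* x)
      square = ℕSolver.solve-∀
      entry-bound : ∀ i j → off i j ℕ.* (d ℕ.* d) ≤ 4 ℕ.* dev² i j
      entry-bound i j with nonzero? (V i) j
      ... | no _ = z≤n
      ... | yes Vᵢⱼ≢0 = begin
        1 ℕ.* (d ℕ.* d)                                      ≡⟨ ℕP.*-identityˡ (d ℕ.* d) ⟩
        d ℕ.* d                                              ≤⟨ ℕP.*-mono-≤ d≤2∣dev∣ d≤2∣dev∣ ⟩
        2 ℕ.* ℤ.∣ dev i j ∣ ℕ.* (2 ℕ.* ℤ.∣ dev i j ∣)        ≡⟨ square ℤ.∣ dev i j ∣ ⟩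
        4 ℕ.* dev² i j                                       ∎
        where
        d≤2∣dev∣ : d ≤ 2 ℕ.* ℤ.∣ dev i j ∣
        d≤2∣dev∣ = far-from-roundDiv c-near λ Mᵢⱼ≡c →
          Vᵢⱼ≢0 (trans (cong (λ x → fromℤ x - fromℤ c) Mᵢⱼ≡c) (ℚP.+-inverseʳ (fromℤ c)))

    q-bound-or-const-block : ∀ r .{{_ : NonZero r}} → RankAtMost M r →
      (+ 1 ℚ./ (128 ℕ.* r)) {{m*n≢0 128 r}} ℚ.≤ q M ⊎ HasConstSubmatrix M (m / 2) (n / 2)
    q-bound-or-const-block r rank≤r = Sum.map
      (λ d³≤128rT → subst (_ ℚ.≤_) (sym q≡sumSq/d³)
        (1/R≤T/d³ {d} {128 ℕ.* r} {{d≢0}} {{m*n≢0 128 r}} d³≤128rT))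
      (λ d³≰128rT → almost-constant⇒const-block M r rank≤r (roundDiv S d)
        (few-off-entries (off-entries-bound (roundDiv S d) (roundDiv-error S d)) d³≰128rT))
      (toSum (d ℕ.* d ℕ.* d ℕP.≤? 128 ℕ.* r ℕ.* sumSq))

open import Data.Nat using (ℕ; NonZero; _*_; _/_)
open import Data.Nat.Properties using (m*n≢0)
open import Data.Nat.Divisibility using (_∣_)
open import Data.Integer using (ℤ; +_)
open import Data.Rational using (_≤_)
open import Relation.Nullary using (¬_)
open import Data.Empty using (⊥-elim)
open import Data.Product.Base using (_,_)
open import Data.Sum.Base using ([_,_]′)
open import Function.Base using (id; _∘_)
open LowRankVariance using (module Deviation)

lemmaA6 : (m n : ℕ) .{{_ : NonZero m}} .{{_ : NonZero n}} → 2 ∣ m → 2 ∣ n →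
    (M : Mat ℤ m n) (r : ℕ) .{{_ : NonZero r}} → HasRank M r →
    ¬ HasConstSubmatrix M (m / 2) (n / 2) →
    Data.Rational._/_ (+ 1) (128 * r) {{m*n≢0 128 r}} ≤ q M
lemmaA6 m n _ _ M r (rank≤r , _) no-const-block =
  [ id , ⊥-elim ∘ no-const-block ]′ (Deviation.q-bound-or-const-block M r rank≤r)
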